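{- Let $n\ge 1$ and $1\le k\le \lceil n/2\rceil$ be integers. The number of partitions $\pi$ into exactly $k$ parts, all distinct, with $\Gamma(\pi)=n$ equals the number of partitions $\lambda$ into odd parts with largest part $\lambda_1=2k-1$ and $\Gamma(\lambda)=n$. Both numbers equal $\binom{n-k}{k-1}$.
   Context: For a non-empty partition $\pi=(\pi_1\ge\cdots\ge\pi_r\ge1)$, $\ell(\pi)=r$ and $\Gamma(\pi)=\pi_1+\ell(\pi)-1$ (length of the largest hook). -}

module Defs where

open import Data.Nat using (ℕ; zero; suc; _+_; _*_; _∸_; _≥_; _>_; _≤_)
open import Data.List using (List; []; _∷_; length)
open import Data.List.Relation.Unary.All using (All)
open import Data.List.Relation.Unary.Linked using (Linked)
open import Data.List.Relation.Unary.Unique.Propositional using (Unique)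
open import Data.List.Membership.Propositional using (_∈_)
open import Data.Product using (Σ; ∃; _×_)
open import Relation.Binary.PropositionalEquality using (_≡_)
open import Function.Bundles using (_⇔_)
open import Data.Empty using (⊥)
open import Data.Unit using (⊤)

-- A partition is a list of parts, weakly decreasing, all ≥ 1.
-- (The empty list is the empty partition; the theorem only concerns non-empty ones.)
IsPartition : List ℕ → Set
IsPartition π = Linked _≥_ π × All (λ p → p ≥ 1) π

NonEmpty : List ℕ → Set
NonEmpty [] = ⊥
NonEmpty (_ ∷ _) = ⊤

largest : List ℕ → ℕ
largest [] = 0
largest (p ∷ _) = p

Γ : List ℕ → ℕ
Γ π = largest π + length π ∸ 1

-- all parts distinct (for a weakly decreasing list: strictly decreasing)
DistinctParts : List ℕ → Set
DistinctParts π = Linked _>_ π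

Odd : ℕ → Set
Odd m = ∃ λ j → m ≡ 2 * j + 1

-- The set of lists satisfying P is finite with exactly c elements:
-- there is a duplicate-free list enumerating exactly the elements satisfying P.
HasCount : (List ℕ → Set) → ℕ → Set
HasCount P c = Σ (List (List ℕ)) λ L →
  Unique L × (∀ x → (x ∈ L) ⇔ P x) × length L ≡ c

-- A partition with k distinct parts and Γ = n has largest part n − k + 1, and its
-- remaining k − 1 parts form an arbitrary (k − 1)-subset of {1, …, n − k}. An odd
-- partition with largest part 2k − 1 and Γ = n has n − 2k + 1 further parts, forming
-- an arbitrary multiset of that size from the k odd numbers 1, 3, …, 2k − 1. Both
-- families therefore have C(n − k, k − 1) members. Both counts come from explicit
-- enumerations that split on whether the top admissible value occurs, which is
-- Pascal's rule.
module Submission where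

open import Defs
open import Data.Nat
open import Data.Nat.Properties
open import Data.Nat.Combinatorics using (_C_; nCn≡1; nCk+nC[k+1]≡[n+1]C[k+1])
open import Data.List using (List; []; _∷_; [_]; length; map; _++_)
open import Data.List.Properties using (length-map; length-++; ∷-injectiveʳ)
open import Data.List.Membership.Propositional using (_∈_)
open import Data.List.Membership.Propositional.Properties
  using (∈-map⁺; ∈-map⁻; ∈-++⁺ˡ; ∈-++⁺ʳ; ∈-++⁻)
open import Data.List.Relation.Unary.Any using (here)
open import Data.List.Relation.Unary.All as All using (All; []; _∷_)
open import Data.List.Relation.Unary.Linked as Linked using (Linked; [-]; _∷_)
open import Data.List.Relation.Unary.Unique.Propositional using (Unique)
import Data.List.Relation.Unary.Unique.Propositional.Properties as Unique
open import Data.List.Relation.Unary.AllPairs using ([]; _∷_)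
open import Data.Product using (∃; _×_; _,_)
open import Data.Sum using (inj₁; inj₂)
open import Data.Unit using (tt)
open import Function.Bundles using (_⇔_; mk⇔; Equivalence)
open import Relation.Binary.PropositionalEquality
  using (_≡_; refl; sym; trans; cong; cong₂; subst; module ≡-Reasoning)
open import Relation.Nullary using (¬_; contradiction)

Linked-weakenHead : ∀ {A : Set} {R : A → A → Set} {x y t} →
  (∀ {z} → R y z → R x z) → Linked R (y ∷ t) → Linked R (x ∷ t)
Linked-weakenHead f [-]     = [-]
Linked-weakenHead f (r ∷ l) = f r ∷ l

Γ-∷ : ∀ p t → Γ (p ∷ t) ≡ p + length t
Γ-∷ p t = cong (_∸ 1) (+-suc p (length t))

HasCount-∷ : ∀ {P : List ℕ → Set} h L {c} → Unique L → length L ≡ c →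
  (∀ t → t ∈ L ⇔ P (h ∷ t)) → (∀ x → P x → ∃ λ t → x ≡ h ∷ t) → HasCount P c
HasCount-∷ {P} h L uniq len tails headed =
  map (h ∷_) L , Unique.map⁺ ∷-injectiveʳ uniq , members , trans (length-map _ L) len
  where
  members : ∀ x → x ∈ map (h ∷_) L ⇔ P x
  members x = mk⇔ to from
    where
    to : x ∈ map (h ∷_) L → P x
    to x∈ with ∈-map⁻ _ x∈
    ... | t , t∈ , refl = Equivalence.to (tails t) t∈
    from : P x → x ∈ map (h ∷_) L
    from px with headed x px
    ... | t , refl = ∈-map⁺ _ (Equivalence.from (tails t) px)

length-map-++ : ∀ (f : List ℕ → List ℕ) xs ys →
  length (map f xs ++ ys) ≡ length xs + length ys
length-map-++ f xs ys = trans (length-++ (map f xs)) (cong (_+ length ys) (length-map f xs))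

StrictChain : ℕ → List ℕ → Set
StrictChain m t = Linked _>_ (suc m ∷ t) × All (λ p → p ≥ 1) t

strictChains : ℕ → ℕ → List (List ℕ)
strictChains m       zero    = [ [] ]
strictChains zero    (suc j) = []
strictChains (suc m) (suc j) = map (suc m ∷_) (strictChains m j) ++ strictChains m (suc j)

strictChains-length : ∀ m j → length (strictChains m j) ≡ m C j
strictChains-length m       zero    = refl
strictChains-length zero    (suc j) = refl
strictChains-length (suc m) (suc j) = begin
  length (strictChains (suc m) (suc j))  ≡⟨ length-map-++ _ (strictChains m j) _ ⟩
  length (strictChains m j) + length (strictChains m (suc j))
    ≡⟨ cong₂ _+_ (strictChains-length m j) (strictChains-length m (suc j)) ⟩
  m C j + m C suc j                      ≡⟨ nCk+nC[k+1]≡[n+1]C[k+1] m j ⟩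
  suc m C suc j                          ∎
  where open ≡-Reasoning

∈-strictChains⁻ : ∀ m j {t} → t ∈ strictChains m j → StrictChain m t × length t ≡ j
∈-strictChains⁻ m       zero    (here refl) = ([-] , []) , refl
∈-strictChains⁻ (suc m) (suc j) t∈ with ∈-++⁻ (map (suc m ∷_) (strictChains m j)) t∈
... | inj₁ t∈₁ with ∈-map⁻ _ t∈₁
...   | t , t∈′ , refl with ∈-strictChains⁻ m j t∈′
...     | (lk , pos) , len = (≤-refl ∷ lk , s≤s z≤n ∷ pos) , cong suc len
∈-strictChains⁻ (suc m) (suc j) t∈ | inj₂ t∈₂ with ∈-strictChains⁻ m (suc j) t∈₂
... | (lk , pos) , len = (Linked-weakenHead m<n⇒m<1+n lk , pos) , len

∈-strictChains⁺ : ∀ m j {t} → StrictChain m t → length t ≡ j → t ∈ strictChains m j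
∈-strictChains⁺ m       zero    {[]}    _                          _   = here refl
∈-strictChains⁺ zero    (suc j) {x ∷ t} (x<1 ∷ _ , x≥1 ∷ _)       _   = contradiction x≥1 (<⇒≱ x<1)
∈-strictChains⁺ (suc m) (suc j) {x ∷ t} (x<m+2 ∷ lk , pos@(_ ∷ pos′)) len
  with m≤n⇒m<n∨m≡n (≤-pred x<m+2)
... | inj₂ refl  = ∈-++⁺ˡ (∈-map⁺ _ (∈-strictChains⁺ m j (lk , pos′) (suc-injective len)))
... | inj₁ x<m+1 = ∈-++⁺ʳ _ (∈-strictChains⁺ m (suc j) (x<m+1 ∷ lk , pos) len)

strictChains-unique : ∀ m j → Unique (strictChains m j)
strictChains-unique m       zero    = [] ∷ []
strictChains-unique zero    (suc j) = []
strictChains-unique (suc m) (suc j) =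
  Unique.++⁺ (Unique.map⁺ ∷-injectiveʳ (strictChains-unique m j))
             (strictChains-unique m (suc j)) disjoint
  where
  disjoint : ∀ {t} → ¬ (t ∈ map (suc m ∷_) (strictChains m j) × t ∈ strictChains m (suc j))
  disjoint (t∈₁ , t∈₂) with ∈-map⁻ _ t∈₁
  ... | _ , _ , refl with ∈-strictChains⁻ m (suc j) t∈₂
  ...   | (m<m ∷ _ , _) , _ = <-irrefl refl m<m

OddChain : ℕ → List ℕ → Set
OddChain a t = Linked _≥_ (2 * a + 1 ∷ t) × All Odd t

odd-mono-≤ : ∀ {i a} → i ≤ a → 2 * i + 1 ≤ 2 * a + 1
odd-mono-≤ i≤a = +-monoˡ-≤ 1 (*-monoʳ-≤ 2 i≤a)

odd-cancel-≤ : ∀ {i a} → 2 * i + 1 ≤ 2 * a + 1 → i ≤ a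
odd-cancel-≤ {i} {a} le = *-cancelˡ-≤ 2 (+-cancelʳ-≤ 1 (2 * i) (2 * a) le)

oddChains : ℕ → ℕ → List (List ℕ)
oddChains a       zero    = [ [] ]
oddChains zero    (suc j) = map (1 ∷_) (oddChains zero j)
oddChains (suc a) (suc j) =
  map (2 * suc a + 1 ∷_) (oddChains (suc a) j) ++ oddChains a (suc j)

oddChains-length : ∀ a j → length (oddChains a j) ≡ (a + j) C a
oddChains-length a       zero    = trans (sym (nCn≡1 a)) (cong (_C a) (sym (+-identityʳ a)))
oddChains-length zero    (suc j) = trans (length-map _ (oddChains zero j)) (oddChains-length zero j)
oddChains-length (suc a) (suc j) = begin
  length (oddChains (suc a) (suc j))  ≡⟨ length-map-++ _ (oddChains (suc a) j) _ ⟩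
  length (oddChains (suc a) j) + length (oddChains a (suc j))
    ≡⟨ cong₂ _+_ (oddChains-length (suc a) j) (oddChains-length a (suc j)) ⟩
  (suc a + j) C suc a + (a + suc j) C a  ≡⟨ cong (λ s → s C suc a + (a + suc j) C a) (sym (+-suc a j)) ⟩
  (a + suc j) C suc a + (a + suc j) C a  ≡⟨ +-comm ((a + suc j) C suc a) _ ⟩
  (a + suc j) C a + (a + suc j) C suc a  ≡⟨ nCk+nC[k+1]≡[n+1]C[k+1] (a + suc j) a ⟩
  (suc a + suc j) C suc a                ∎
  where open ≡-Reasoning

∈-oddChains⁻ : ∀ a j {t} → t ∈ oddChains a j → OddChain a t × length t ≡ j
∈-oddChains⁻ a       zero    (here refl) = ([-] , []) , refl
∈-oddChains⁻ zero    (suc j) t∈ with ∈-map⁻ _ t∈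
... | t , t∈′ , refl with ∈-oddChains⁻ zero j t∈′
...   | (lk , odd) , len = (≤-refl ∷ lk , (0 , refl) ∷ odd) , cong suc len
∈-oddChains⁻ (suc a) (suc j) t∈ with ∈-++⁻ (map (2 * suc a + 1 ∷_) (oddChains (suc a) j)) t∈
... | inj₁ t∈₁ with ∈-map⁻ _ t∈₁
...   | t , t∈′ , refl with ∈-oddChains⁻ (suc a) j t∈′
...     | (lk , odd) , len = (≤-refl ∷ lk , (suc a , refl) ∷ odd) , cong suc len
∈-oddChains⁻ (suc a) (suc j) t∈ | inj₂ t∈₂ with ∈-oddChains⁻ a (suc j) t∈₂
... | (lk , odd) , len =
  (Linked-weakenHead (λ le → ≤-trans le (odd-mono-≤ (n≤1+n a))) lk , odd) , len

∈-oddChains⁺ : ∀ a j {t} → OddChain a t → length t ≡ j → t ∈ oddChains a j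
∈-oddChains⁺ a       zero    {[]}    _                                _   = here refl
∈-oddChains⁺ zero    (suc j) {x ∷ t} (_ ∷ lk , (zero , refl) ∷ odd) len =
  ∈-map⁺ _ (∈-oddChains⁺ zero j (lk , odd) (suc-injective len))
∈-oddChains⁺ zero    (suc j) {x ∷ t} (x≤1 ∷ _ , (suc i , refl) ∷ _) _ =
  contradiction (odd-cancel-≤ {suc i} {0} x≤1) λ ()
∈-oddChains⁺ (suc a) (suc j) {x ∷ t} (x≤ ∷ lk , odd@((i , refl) ∷ odd′)) len
  with m≤n⇒m<n∨m≡n (odd-cancel-≤ {i} {suc a} x≤)
... | inj₂ refl  = ∈-++⁺ˡ (∈-map⁺ _ (∈-oddChains⁺ (suc a) j (lk , odd′) (suc-injective len)))
... | inj₁ i<a+1 = ∈-++⁺ʳ _ (∈-oddChains⁺ a (suc j) (odd-mono-≤ (≤-pred i<a+1) ∷ lk , odd) len)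

oddChains-unique : ∀ a j → Unique (oddChains a j)
oddChains-unique a       zero    = [] ∷ []
oddChains-unique zero    (suc j) = Unique.map⁺ ∷-injectiveʳ (oddChains-unique zero j)
oddChains-unique (suc a) (suc j) =
  Unique.++⁺ (Unique.map⁺ ∷-injectiveʳ (oddChains-unique (suc a) j))
             (oddChains-unique a (suc j)) disjoint
  where
  disjoint : ∀ {t} →
    ¬ (t ∈ map (2 * suc a + 1 ∷_) (oddChains (suc a) j) × t ∈ oddChains a (suc j))
  disjoint (t∈₁ , t∈₂) with ∈-map⁻ _ t∈₁
  ... | _ , _ , refl with ∈-oddChains⁻ a (suc j) t∈₂
  ...   | (too-big ∷ _ , _) , _ = 1+n≰n (odd-cancel-≤ too-big)

Γ-∷-head : ∀ p t {n} → Γ (p ∷ t) ≡ n → p ≡ n ∸ length t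
Γ-∷-head p t γ = trans (sym (m+n∸n≡m p (length t))) (cong (_∸ length t) (trans (sym (Γ-∷ p t)) γ))

Γ-∷-length : ∀ p t {n} → Γ (p ∷ t) ≡ n → length t ≡ n ∸ p
Γ-∷-length p t γ = trans (sym (m+n∸m≡n p (length t))) (cong (_∸ p) (trans (sym (Γ-∷ p t)) γ))

m≤⌈n/2⌉⇒m+m≤1+n : ∀ {m n} → m ≤ ⌈ n /2⌉ → m + m ≤ suc n
m≤⌈n/2⌉⇒m+m≤1+n {m} {n} m≤⌈n/2⌉ = begin
  m + m                          ≤⟨ +-mono-≤ m≤⌈n/2⌉ m≤⌈n/2⌉ ⟩
  ⌊ suc n /2⌋ + ⌊ suc n /2⌋      ≤⟨ +-monoʳ-≤ ⌊ suc n /2⌋ (⌊n/2⌋≤⌈n/2⌉ (suc n)) ⟩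
  ⌊ suc n /2⌋ + ⌈ suc n /2⌉      ≡⟨ ⌊n/2⌋+⌈n/2⌉≡n (suc n) ⟩
  suc n                          ∎
  where open ≤-Reasoning

DistinctPartition : ℕ → ℕ → List ℕ → Set
DistinctPartition k n π =
  IsPartition π × NonEmpty π × DistinctParts π × length π ≡ k × Γ π ≡ n

distinctPartitions-count : ∀ n j → suc j ≤ n →
  HasCount (DistinctPartition (suc j) n) ((n ∸ suc j) C j)
distinctPartitions-count n j j<n =
  HasCount-∷ (suc m) (strictChains m j) (strictChains-unique m j) (strictChains-length m j)
             tails headed
  where
  m = n ∸ suc j

  Γ-tail : ∀ t → length t ≡ j → Γ (suc m ∷ t) ≡ n
  Γ-tail t len = begin
    Γ (suc m ∷ t)    ≡⟨ Γ-∷ (suc m) t ⟩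
    suc m + length t ≡⟨ cong (suc m +_) len ⟩
    suc m + j        ≡⟨ +-suc m j ⟨
    m + suc j        ≡⟨ m∸n+n≡m j<n ⟩
    n                ∎
    where open ≡-Reasoning

  tails : ∀ t → t ∈ strictChains m j ⇔ DistinctPartition (suc j) n (suc m ∷ t)
  tails t = mk⇔ to from
    where
    to : t ∈ strictChains m j → DistinctPartition (suc j) n (suc m ∷ t)
    to t∈ with ∈-strictChains⁻ m j t∈
    ... | (lk , pos) , len =
      (Linked.map <⇒≤ lk , s≤s z≤n ∷ pos) , tt , lk , cong suc len , Γ-tail t len
    from : DistinctPartition (suc j) n (suc m ∷ t) → t ∈ strictChains m j
    from ((_ , _ ∷ pos) , _ , lk , len , _) = ∈-strictChains⁺ m j (lk , pos) (suc-injective len)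

  headed : ∀ π → DistinctPartition (suc j) n π → ∃ λ t → π ≡ suc m ∷ t
  headed (p ∷ t) (_ , _ , _ , len , γ) = t , cong (_∷ t) (begin
    p              ≡⟨ Γ-∷-head p t γ ⟩
    n ∸ length t   ≡⟨ cong (n ∸_) (suc-injective len) ⟩
    suc n ∸ suc j  ≡⟨ +-∸-assoc 1 j<n ⟩
    suc m          ∎)
    where open ≡-Reasoning

OddPartition : ℕ → ℕ → List ℕ → Set
OddPartition c n λ′ = IsPartition λ′ × NonEmpty λ′ × All Odd λ′ × largest λ′ ≡ c × Γ λ′ ≡ n

odd⇒≥1 : ∀ {m} → Odd m → m ≥ 1
odd⇒≥1 (j , refl) = m≤n+m 1 (2 * j)

oddPartitions-count : ∀ n a c → c ≡ 2 * a + 1 → c ≤ n →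
  HasCount (OddPartition c n) ((n ∸ suc a) C a)
oddPartitions-count n a c@.(2 * a + 1) refl c≤n =
  HasCount-∷ c (oddChains a r) (oddChains-unique a r)
             (trans (oddChains-length a r) (cong (_C a) a+r≡n∸[1+a])) tails headed
  where
  r = n ∸ c

  a+r≡n∸[1+a] : a + r ≡ n ∸ suc a
  a+r≡n∸[1+a] = begin
    a + r                       ≡⟨ m+n∸m≡n (suc a) (a + r) ⟨
    suc a + (a + r) ∸ suc a     ≡⟨ cong (_∸ suc a) (+-assoc (suc a) a r) ⟨
    suc a + a + r ∸ suc a       ≡⟨ cong (λ s → s + r ∸ suc a) c≡1+a+a ⟨
    c + r ∸ suc a               ≡⟨ cong (_∸ suc a) (m+[n∸m]≡n c≤n) ⟩
    n ∸ suc a                   ∎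
    where
    open ≡-Reasoning
    c≡1+a+a : c ≡ suc a + a
    c≡1+a+a = trans (+-comm (2 * a) 1) (cong (λ s → suc (a + s)) (+-identityʳ a))

  tails : ∀ t → t ∈ oddChains a r ⇔ OddPartition c n (c ∷ t)
  tails t = mk⇔ to from
    where
    to : t ∈ oddChains a r → OddPartition c n (c ∷ t)
    to t∈ with ∈-oddChains⁻ a r t∈
    ... | (lk , odd) , len =
      (lk , All.map odd⇒≥1 ((a , refl) ∷ odd)) , tt , (a , refl) ∷ odd , refl ,
      trans (Γ-∷ c t) (trans (cong (c +_) len) (m+[n∸m]≡n c≤n))
    from : OddPartition c n (c ∷ t) → t ∈ oddChains a r
    from ((lk , _) , _ , _ ∷ odd , _ , γ) = ∈-oddChains⁺ a r (lk , odd) (Γ-∷-length c t γ)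

  headed : ∀ λ′ → OddPartition c n λ′ → ∃ λ t → λ′ ≡ c ∷ t
  headed (.c ∷ t) (_ , _ , _ , refl , _) = t , refl

theorem2p7 : (n k : ℕ) → 1 ≤ n → 1 ≤ k → k ≤ ⌈ n /2⌉ →
    HasCount (λ π → IsPartition π × NonEmpty π × DistinctParts π
                    × length π ≡ k × Γ π ≡ n)
             ((n ∸ k) C (k ∸ 1))
    × HasCount (λ λ′ → IsPartition λ′ × NonEmpty λ′ × All Odd λ′
                       × largest λ′ ≡ 2 * k ∸ 1 × Γ λ′ ≡ n)
             ((n ∸ k) C (k ∸ 1))
theorem2p7 n zero    _ () _
theorem2p7 n (suc j) _ _  k≤⌈n/2⌉ =
  distinctPartitions-count n j k≤n , oddPartitions-count n j (2 * suc j ∸ 1) 2k∸1≡2j+1 2k∸1≤n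
  where
  j+k≤n : j + suc j ≤ n
  j+k≤n = ≤-pred (m≤⌈n/2⌉⇒m+m≤1+n k≤⌈n/2⌉)

  k≤n : suc j ≤ n
  k≤n = ≤-trans (m≤n+m (suc j) j) j+k≤n

  2k∸1≡2j+1 : 2 * suc j ∸ 1 ≡ 2 * j + 1
  2k∸1≡2j+1 = trans (+-suc j (j + 0)) (+-comm 1 (2 * j))

  2k∸1≤n : 2 * suc j ∸ 1 ≤ n
  2k∸1≤n = subst (λ s → j + suc s ≤ n) (sym (+-identityʳ j)) j+k≤n
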